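{- Let $E_\tau\in S_\mathbb{T}$. Either for all base types $\sigma\in\mathcal{B}$ it holds that $\mathit{App}(E_\sigma)$ is a complete join semilattice, or for all $b\in\mathit{App}(E_\tau)$ and all $e\in\mathcal{E}_\tau$, if $e\leq_{\mathit{App}(E_\tau)} b$, then $b\in\mathcal{E}_\tau$.
   Context: Setting: a higher-order language whose type hierarchy $\mathbb{H}$ consists of base types, product types $\Pi_{i\in I}\tau_i$ and morphism types $\tau_1\to\tau_2$. Each base type $\tau$ is assigned a poset $E_\tau$ (its semantics); inductively $E_{\Pi_{i\in I}\tau_i}=\Pi_{i\in I}E_{\tau_i}$ (Cartesian product with product order) and $E_{\tau_1\to\tau_2}$ is the poset of all functions $E_{\tau_1}\to E_{\tau_2}$ with the pointwise order. A subset $\mathbb{T}\subseteq\mathbb{H}$ is fixed and $S_\mathbb{T}$ is the set containing $E_\tau$ for all $\tau\in\mathbb{T}$, containing $E_{\tau_2}$ whenever it contains $E_{\tau_1\to\tau_2}$, and containing each $E_{\tau_i}$ whenever it contains $E_{\Pi_{i\in I}\tau_i}$; $\mathcal{B}$ denotes the base types in $\mathbb{T}$. An approximation system $(\mathbf{Approx},\mathit{App},\{\mathcal{E}_\tau\}_{\tau\in\mathcal{B}},\{\mathfrak{p}^0_\tau\}_{\tau\in\mathcal{B}})$ for $S_\mathbb{T}$ consists of: (1) a Cartesian closed full subcategory $\mathbf{Approx}$ of the category of chain-complete posets with monotone maps (products are Cartesian products with product order; the exponential $B^A$ is the set of monotone maps $A\to B$ with pointwise order); (2) a function $\mathit{App}$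 from $S_\mathbb{T}$ to objects of $\mathbf{Approx}$ with $\mathit{App}(E_{\Pi_{i\in I}\tau_i})=\Pi_{i\in I}\mathit{App}(E_{\tau_i})$, $\mathit{App}(E_{\tau_1\to\tau_2})=\mathit{App}(\Pi_{i\in E_{\tau_1}}E_{\tau_2})$ if $E_{\tau_1}\notin S_\mathbb{T}$, and $\mathit{App}(E_{\tau_1\to\tau_2})=\mathit{App}(E_{\tau_2})^{\mathit{App}(E_{\tau_1})}$ if $E_{\tau_1}\in S_\mathbb{T}$; (3) for each base type $\tau$ a set $\mathcal{E}_\tau\subseteq\mathit{App}(E_\tau)$, such that either $\mathit{App}(E_\tau)$ is a complete join semilattice for all base $\tau$, or for all base $\tau$ the set $\mathcal{E}_\tau$ is upward closed in $\mathit{App}(E_\tau)$; (4) for each base type $\tau$ a surjection $\mathfrak{p}^0_\tau\colon\mathcal{E}_\tau\to E_\tau$ such that $a\leq b$ in $\mathcal{E}_\tau$ implies $\mathfrak{p}^0_\tau(a)=\mathfrak{p}^0_\tau(b)$, and for each $e\in E_\tau$ the greatest lower bound of $(\mathfrak{p}^0_\tau)^{ -1}(e)$ exists, lies in $\mathcal{E}_\tau$, and is mapped to $e$. Exact elements are extended to all $E_\tau\in S_\mathbb{T}$: for base $\tau$, $e$ is exact iff $e\in\mathcal{E}_\tau$; for $\tau=\Pi_{i\in I}\tau_i$, iff every component is exact; for $\tau=\tau_1\to\tau_2$ with $E_{\tau_1}\notin S_\mathbb{T}$, iff every component (as an element of $\Pi_{i\in E_{\tau_1}}\mathit{App}(E_{\tau_2})$)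 is exact; for $\tau=\tau_1\to\tau_2$ with $E_{\tau_1}\in S_\mathbb{T}$, iff $e$ maps every exact element of $\mathit{App}(E_{\tau_1})$ to an exact element of $\mathit{App}(E_{\tau_2})$. $\mathcal{E}_\tau$ denotes the set of exact elements of $\mathit{App}(E_\tau)$. -}

module Defs where

open import Level using (0ℓ)
open import Data.Product using (Σ; ∃; _×_; _,_; proj₁)
open import Data.Sum using (_⊎_)
open import Relation.Nullary using (Dec; yes; no)
open import Relation.Binary.Bundles using (Poset)

data Ty (B : Set) : Set₁ where
  base : B → Ty B
  prod : (I : Set) → (I → Ty B) → Ty B
  arr  : Ty B → Ty B → Ty B

module _ (P : Poset 0ℓ 0ℓ 0ℓ) where
  open Poset P

  IsUpperBound : (Carrier → Set) → Carrier → Set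
  IsUpperBound S x = ∀ y → S y → y ≤ x

  IsLowerBound : (Carrier → Set) → Carrier → Set
  IsLowerBound S x = ∀ y → S y → x ≤ y

  IsLUB : (Carrier → Set) → Carrier → Set
  IsLUB S x = IsUpperBound S x × (∀ z → IsUpperBound S z → x ≤ z)

  IsGLB : (Carrier → Set) → Carrier → Set
  IsGLB S x = IsLowerBound S x × (∀ z → IsLowerBound S z → z ≤ x)

  IsChain : (Carrier → Set) → Set
  IsChain S = ∀ x y → S x → S y → (x ≤ y) ⊎ (y ≤ x)

  ChainComplete : Set₁
  ChainComplete = ∀ (S : Carrier → Set) → IsChain S → Σ Carrier (IsLUB S)

  CompleteJoinSemilattice : Set₁
  CompleteJoinSemilattice = ∀ (S : Carrier → Set) → Σ Carrier (IsLUB S)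

  UpwardClosed : (Carrier → Set) → Set
  UpwardClosed S = ∀ a b → S a → a ≤ b → S b

-- The set S_𝕋 (represented by the types whose semantics it contains)

module _ {B : Set} (T : Ty B → Set) where

  data InS : Ty B → Set₁ where
    fromT : ∀ {τ} → T τ → InS τ
    cod   : ∀ {τ₁ τ₂} → InS (arr τ₁ τ₂) → InS τ₂
    comp  : ∀ {I : Set} {τs : I → Ty B} → InS (prod I τs) → (i : I) → InS (τs i)

module Sem {B : Set} (T : Ty B → Set)
           (dec : (τ : Ty B) → Dec (InS T τ))
           (EB : B → Poset 0ℓ 0ℓ 0ℓ)                 -- E_σ for base σ
           (AppB : B → Poset 0ℓ 0ℓ 0ℓ)               -- App(E_σ) for base σ
           (ExB : (σ : B) → Poset.Carrier (AppB σ) → Set)  -- 𝓔_σ for base σ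
           where

  EC : Ty B → Set
  EC (base σ)    = Poset.Carrier (EB σ)
  EC (prod I τs) = (i : I) → EC (τs i)
  EC (arr τ₁ τ₂) = EC τ₁ → EC τ₂

  -- carrier and order of App(E_τ)
  AC : Ty B → Set
  AL : (τ : Ty B) → AC τ → AC τ → Set
  ACarr : {τ₁ : Ty B} → Dec (InS T τ₁) → Ty B → Set
  ALarr : {τ₁ : Ty B} (d : Dec (InS T τ₁)) (τ₂ : Ty B) → ACarr d τ₂ → ACarr d τ₂ → Set

  AC (base σ)    = Poset.Carrier (AppB σ)
  AC (prod I τs) = (i : I) → AC (τs i)
  AC (arr τ₁ τ₂) = ACarr (dec τ₁) τ₂

  ACarr {τ₁} (yes _) τ₂ = Σ (AC τ₁ → AC τ₂) λ f → ∀ x y → AL τ₁ x y → AL τ₂ (f x) (f y)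
  ACarr {τ₁} (no _)  τ₂ = EC τ₁ → AC τ₂

  AL (base σ)    a b = Poset._≤_ (AppB σ) a b
  AL (prod I τs) a b = ∀ i → AL (τs i) (a i) (b i)
  AL (arr τ₁ τ₂) f g = ALarr (dec τ₁) τ₂ f g

  ALarr {τ₁} (yes _) τ₂ f g = ∀ x → AL τ₂ (proj₁ f x) (proj₁ g x)
  ALarr {τ₁} (no _)  τ₂ f g = ∀ i → AL τ₂ (f i) (g i)

  -- exact elements 𝓔_τ ⊆ App(E_τ)
  Exact : (τ : Ty B) → AC τ → Set
  Exarr : {τ₁ : Ty B} (d : Dec (InS T τ₁)) (τ₂ : Ty B) → ACarr d τ₂ → Set

  Exact (base σ)    a = ExB σ a
  Exact (prod I τs) a = ∀ i → Exact (τs i) (a i)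
  Exact (arr τ₁ τ₂) f = Exarr (dec τ₁) τ₂ f

  Exarr {τ₁} (yes _) τ₂ f = ∀ x → Exact τ₁ x → Exact τ₂ (proj₁ f x)
  Exarr {τ₁} (no _)  τ₂ f = ∀ i → Exact τ₂ (f i)

record IsApproxSystem {B : Set} (T : Ty B → Set)
         (EB AppB : B → Poset 0ℓ 0ℓ 0ℓ)
         (ExB : (σ : B) → Poset.Carrier (AppB σ) → Set) : Set₁ where
  field
    -- (1) App(E_σ) are objects of Approx, i.e. chain-complete posets
    chainComplete : ∀ σ → InS T (base σ) → ChainComplete (AppB σ)
    cjsOrUpward   : (∀ σ → InS T (base σ) → CompleteJoinSemilattice (AppB σ))
                    ⊎ (∀ σ → InS T (base σ) → UpwardClosed (AppB σ) (ExB σ))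
    p0      : ∀ σ → (a : Poset.Carrier (AppB σ)) → ExB σ a → Poset.Carrier (EB σ)
    p0-surj : ∀ σ → InS T (base σ) → ∀ e →
              ∃ λ a → Σ (ExB σ a) λ ea → Poset._≈_ (EB σ) (p0 σ a ea) e
    p0-mono : ∀ σ → InS T (base σ) → ∀ a b (ea : ExB σ a) (eb : ExB σ b) →
              Poset._≤_ (AppB σ) a b → Poset._≈_ (EB σ) (p0 σ a ea) (p0 σ b eb)
    p0-glb  : ∀ σ → InS T (base σ) → ∀ e →
              ∃ λ g → IsGLB (AppB σ) (λ a → Σ (ExB σ a) λ ea → Poset._≈_ (EB σ) (p0 σ a ea) e) g
                       × Σ (ExB σ g) λ eg → Poset._≈_ (EB σ) (p0 σ g eg) e

module Submission where

open import Defs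
open import Level using (0ℓ)
open import Data.Sum using (_⊎_; inj₁; inj₂)
open import Data.Product using (proj₁)
open import Relation.Nullary using (Dec; yes; no)
open import Relation.Binary.Bundles using (Poset)

-- Exactness is defined by structural recursion on the type, and every clause is
-- monotone in the element: products and families are compared componentwise,
-- and a morphism is exact when its values at exact arguments are exact.  So
-- upward closure at the base types of S_𝕋 propagates to every type of S_𝕋.

module ExactUpwardClosed {B : Set} (T : Ty B → Set)
    (dec : (τ : Ty B) → Dec (InS T τ))
    (EB AppB : B → Poset 0ℓ 0ℓ 0ℓ)
    (ExB : (σ : B) → Poset.Carrier (AppB σ) → Set)
    (base-upwardClosed : ∀ σ → InS T (base σ) → UpwardClosed (AppB σ) (ExB σ))
    where
  open Sem T dec EB AppB ExB

  exact-upwardClosed : (τ : Ty B) → InS T τ →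
                       ∀ (b e : AC τ) → Exact τ e → AL τ e b → Exact τ b
  exarr-upwardClosed : {τ₁ : Ty B} (d : Dec (InS T τ₁)) (τ₂ : Ty B) → InS T τ₂ →
                       ∀ (g f : ACarr d τ₂) → Exarr d τ₂ f → ALarr d τ₂ f g → Exarr d τ₂ g

  exact-upwardClosed (base σ)    s b e e-exact e≤b =
    base-upwardClosed σ s e b e-exact e≤b
  exact-upwardClosed (prod I τs) s b e e-exact e≤b i =
    exact-upwardClosed (τs i) (comp s i) (b i) (e i) (e-exact i) (e≤b i)
  exact-upwardClosed (arr τ₁ τ₂) s b e e-exact e≤b =
    exarr-upwardClosed (dec τ₁) τ₂ (cod s) b e e-exact e≤b

  -- The domain occurs only in the hypothesis "x is exact", so no closure
  -- property of τ₁ (nor membership of τ₁ in S_𝕋) is needed.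
  exarr-upwardClosed (yes _) τ₂ s g f f-exact f≤g x x-exact =
    exact-upwardClosed τ₂ s (proj₁ g x) (proj₁ f x) (f-exact x x-exact) (f≤g x)
  exarr-upwardClosed (no _)  τ₂ s g f f-exact f≤g i =
    exact-upwardClosed τ₂ s (g i) (f i) (f-exact i) (f≤g i)

proposition3 : {B : Set} (T : Ty B → Set)
               (dec : (τ : Ty B) → Dec (InS T τ))
               (EB AppB : B → Poset 0ℓ 0ℓ 0ℓ)
               (ExB : (σ : B) → Poset.Carrier (AppB σ) → Set) →
               IsApproxSystem T EB AppB ExB →
               (τ : Ty B) → InS T τ →
               (∀ σ → InS T (base σ) → CompleteJoinSemilattice (AppB σ))
               ⊎ (∀ (b e : Sem.AC T dec EB AppB ExB τ) →
                    Sem.Exact T dec EB AppB ExB τ e →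
                    Sem.AL T dec EB AppB ExB τ e b →
                    Sem.Exact T dec EB AppB ExB τ b)
proposition3 T dec EB AppB ExB system τ τ∈S with IsApproxSystem.cjsOrUpward system
... | inj₁ joinSemilattices = inj₁ joinSemilattices
... | inj₂ upwardClosed     =
  inj₂ (ExactUpwardClosed.exact-upwardClosed T dec EB AppB ExB upwardClosed τ τ∈S)
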